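{- Let $E$ be a finite set, let $S\subseteq 2^E$ be a powerful set, and let $e\in E$. Then the set $S/e:=\{X\subseteq E\setminus\{e\}\mid X\in S\}$, regarded as a family of subsets of the ground set $E\setminus\{e\}$, is a powerful set.
   Context: For a finite ground set $E$, a family $S\subseteq 2^E$ is called a powerful set if for every $X\subseteq E$ the number of members $Y\in S$ with $Y\cap X=\emptyset$ is a power of $2$ (i.e. equals $2^k$ for some integer $k\ge 0$). -}

module Defs where

open import Data.Nat using (ℕ; suc; _^_)
open import Data.Bool using (Bool; true; false; _∧_; if_then_else_)
open import Data.Fin using (Fin)
open import Data.Fin.Subset using (Subset; _∩_; ⊥)
open import Data.Vec using (Vec; []; _∷_; insertAt)
open import Data.Vec.Properties using (≡-dec)
open import Data.Bool.Properties using () renaming (_≟_ to _≟ᵇ_)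
open import Data.List using (List; []; _∷_; map; _++_; length; filter)
open import Data.Product using (∃)
open import Relation.Binary.PropositionalEquality using (_≡_)
open import Relation.Nullary.Decidable using (⌊_⌋)

Family : ℕ → Set
Family m = Subset m → Bool

allSubsets : (m : ℕ) → List (Subset m)
allSubsets 0       = [] ∷ []
allSubsets (suc m) = map (true ∷_) (allSubsets m) ++ map (false ∷_) (allSubsets m)

disjoint? : {m : ℕ} → Subset m → Subset m → Bool
disjoint? Y X = ⌊ ≡-dec _≟ᵇ_ (Y ∩ X) ⊥ ⌋

countDisjoint : {m : ℕ} → Family m → Subset m → ℕ
countDisjoint {m} S X =
  length (filter (λ Y → Data.Bool.T? (S Y ∧ disjoint? Y X)) (allSubsets m))

IsPowerOfTwo : ℕ → Set
IsPowerOfTwo k = ∃ λ j → k ≡ 2 ^ j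

Powerful : {m : ℕ} → Family m → Set
Powerful {m} S = (X : Subset m) → IsPowerOfTwo (countDisjoint S X)

-- S / e : the subsets of E ∖ {e} belonging to S, regarded as a family over
-- the ground set E ∖ {e} ≅ Fin n (identified via Fin.punchIn e, i.e. a subset
-- of Fin n is turned into a subset of Fin (suc n) avoiding e by inserting
-- 'false' at position e).
contract : {n : ℕ} → Family (suc n) → Fin (suc n) → Family n
contract S e X = S (insertAt X e false)

-- Counting over all subsets of E by the value at e: a subset containing e is
-- never disjoint from X ∪ {e}, and a subset Z avoiding e is disjoint from
-- X ∪ {e} exactly when it is disjoint from X.  Hence the number of members of
-- S / e disjoint from X equals the number of members of S disjoint from
-- X ∪ {e}, which is a power of two.
module Submission where

open import Defs
open import Data.Nat using (ℕ; suc; _+_)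
open import Data.Nat.Properties using (+-commutativeSemigroup)
open import Algebra.Properties.CommutativeSemigroup +-commutativeSemigroup using (interchange)
open import Data.Bool using (Bool; true; false; _∧_; T?)
open import Data.Bool.Properties using (∧-zeroʳ; _≟_)
open import Relation.Nullary.Decidable using (does; isYes≗does)
open import Data.Fin using (Fin) renaming (zero to fzero; suc to fsuc)
open import Data.Fin.Subset using (Subset; _∩_; ⊥)
open import Data.Vec using (_∷_; insertAt)
open import Data.Vec.Properties using (≡-dec)
open import Data.List using (List; []; _∷_; map; _++_; length; filter)
open import Data.List.Properties using (length-++; filter-++)
open import Data.Product using (map₂)
open import Function using (_∘_)
open import Relation.Binary.PropositionalEquality

countBy : {A : Set} → (A → Bool) → List A → ℕ
countBy p = length ∘ filter (T? ∘ p)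

module _ {A : Set} where

  countBy-++ : (p : A → Bool) (xs ys : List A) →
               countBy p (xs ++ ys) ≡ countBy p xs + countBy p ys
  countBy-++ p xs ys = trans (cong length (filter-++ (T? ∘ p) xs ys)) (length-++ (filter (T? ∘ p) xs))

  countBy-cong : {p q : A → Bool} → (∀ x → p x ≡ q x) → (xs : List A) →
                 countBy p xs ≡ countBy q xs
  countBy-cong p≗q [] = refl
  countBy-cong {p} {q} p≗q (x ∷ xs) with p x | q x | p≗q x
  ... | true  | .true  | refl = cong suc (countBy-cong p≗q xs)
  ... | false | .false | refl = countBy-cong p≗q xs

  countBy-none : {p : A → Bool} → (∀ x → p x ≡ false) → (xs : List A) → countBy p xs ≡ 0
  countBy-none none [] = refl
  countBy-none none (x ∷ xs) rewrite none x = countBy-none none xs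

countBy-map : {A B : Set} (p : B → Bool) (f : A → B) (xs : List A) →
              countBy p (map f xs) ≡ countBy (p ∘ f) xs
countBy-map p f [] = refl
countBy-map p f (x ∷ xs) with p (f x)
... | true  = cong suc (countBy-map p f xs)
... | false = countBy-map p f xs

countBy-allSubsets-insertAt :
  {n : ℕ} (e : Fin (suc n)) (p : Subset (suc n) → Bool) →
  countBy p (allSubsets (suc n)) ≡
  countBy (λ Z → p (insertAt Z e true)) (allSubsets n) + countBy (λ Z → p (insertAt Z e false)) (allSubsets n)
countBy-allSubsets-insertAt {n} fzero p =
  trans (countBy-++ p (map (true ∷_) (allSubsets n)) (map (false ∷_) (allSubsets n)))
        (cong₂ _+_ (countBy-map p (true ∷_) (allSubsets n)) (countBy-map p (false ∷_) (allSubsets n)))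
countBy-allSubsets-insertAt {suc n} (fsuc e) p = begin
    countBy p (allSubsets (suc (suc n)))
  ≡⟨ countBy-allSubsets-insertAt fzero p ⟩
    countBy (p ∘ (true ∷_)) (allSubsets (suc n)) + countBy (p ∘ (false ∷_)) (allSubsets (suc n))
  ≡⟨ cong₂ _+_ (countBy-allSubsets-insertAt e (p ∘ (true ∷_)))
               (countBy-allSubsets-insertAt e (p ∘ (false ∷_))) ⟩
    (count true true + count true false) + (count false true + count false false)
  ≡⟨ interchange (count true true) (count true false) (count false true) (count false false) ⟩
    (count true true + count false true) + (count true false + count false false)
  ≡⟨ sym (cong₂ _+_ (countBy-allSubsets-insertAt fzero (λ Z → p (insertAt Z (fsuc e) true)))
                    (countBy-allSubsets-insertAt fzero (λ Z → p (insertAt Z (fsuc e) false)))) ⟩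
    countBy (λ Z → p (insertAt Z (fsuc e) true)) (allSubsets (suc n)) +
    countBy (λ Z → p (insertAt Z (fsuc e) false)) (allSubsets (suc n))
  ∎
  where
  open ≡-Reasoning
  count : Bool → Bool → ℕ
  count a b = countBy (λ Z → p (a ∷ insertAt Z e b)) (allSubsets n)

disjoint?-∷ : {n : ℕ} (y x : Bool) (Y X : Subset n) →
              disjoint? (y ∷ Y) (x ∷ X) ≡ does (y ∧ x ≟ false) ∧ disjoint? Y X
disjoint?-∷ y x Y X =
  trans (isYes≗does (≡-dec _≟_ (y ∧ x ∷ Y ∩ X) ⊥))
        (cong (does (y ∧ x ≟ false) ∧_) (sym (isYes≗does (≡-dec _≟_ (Y ∩ X) ⊥))))

disjoint?-insertAt-true : {n : ℕ} (e : Fin (suc n)) (Y X : Subset n) →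
                          disjoint? (insertAt Y e true) (insertAt X e true) ≡ false
disjoint?-insertAt-true fzero Y X = refl
disjoint?-insertAt-true (fsuc e) (y ∷ Y) (x ∷ X) =
  trans (disjoint?-∷ y x (insertAt Y e true) (insertAt X e true))
        (trans (cong (does (y ∧ x ≟ false) ∧_) (disjoint?-insertAt-true e Y X)) (∧-zeroʳ _))

disjoint?-insertAt-false : {n : ℕ} (e : Fin (suc n)) (b : Bool) (Y X : Subset n) →
                           disjoint? (insertAt Y e false) (insertAt X e b) ≡ disjoint? Y X
disjoint?-insertAt-false fzero b Y X = disjoint?-∷ false b Y X
disjoint?-insertAt-false (fsuc e) b (y ∷ Y) (x ∷ X) =
  trans (disjoint?-∷ y x (insertAt Y e false) (insertAt X e b))
        (trans (cong (does (y ∧ x ≟ false) ∧_) (disjoint?-insertAt-false e b Y X))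
               (sym (disjoint?-∷ y x Y X)))

countDisjoint-contract : {n : ℕ} (S : Family (suc n)) (e : Fin (suc n)) (X : Subset n) →
                         countDisjoint (contract S e) X ≡ countDisjoint S (insertAt X e true)
countDisjoint-contract {n} S e X = sym (begin
    countDisjoint S (insertAt X e true)
  ≡⟨ countBy-allSubsets-insertAt e (λ Y → S Y ∧ disjoint? Y (insertAt X e true)) ⟩
    countBy (λ Z → S (insertAt Z e true) ∧ disjoint? (insertAt Z e true) (insertAt X e true)) (allSubsets n) +
    countBy (λ Z → S (insertAt Z e false) ∧ disjoint? (insertAt Z e false) (insertAt X e true)) (allSubsets n)
  ≡⟨ cong₂ _+_ (countBy-none containing-e (allSubsets n)) (countBy-cong avoiding-e (allSubsets n)) ⟩
    countDisjoint (contract S e) X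
  ∎)
  where
  open ≡-Reasoning
  containing-e : ∀ Z → S (insertAt Z e true) ∧ disjoint? (insertAt Z e true) (insertAt X e true) ≡ false
  containing-e Z = trans (cong (_ ∧_) (disjoint?-insertAt-true e Z X)) (∧-zeroʳ _)
  avoiding-e : ∀ Z → S (insertAt Z e false) ∧ disjoint? (insertAt Z e false) (insertAt X e true)
                   ≡ S (insertAt Z e false) ∧ disjoint? Z X
  avoiding-e Z = cong (_ ∧_) (disjoint?-insertAt-false e true Z X)

theorem1 : (n : ℕ) (S : Family (suc n)) (e : Fin (suc n)) →
           Powerful S → Powerful (contract S e)
theorem1 n S e powerful X = map₂ (trans (countDisjoint-contract S e X)) (powerful (insertAt X e true))
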